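{- Let $c_1,\dots,c_d$ be complex constants such that the characteristic polynomial $t^d-c_1t^{d-1}-\cdots-c_d$ has $d$ distinct nonzero roots $r_1,\dots,r_d$, and let $p$ be a positive integer such that no product $r_{m_1}r_{m_2}\cdots r_{m_p}$ (with $1\le m_j\le d$, repetitions allowed) equals $1$. Then there exist constants $\Lambda_{i_1,\dots,i_p}$ ($0\le i_1,\dots,i_p\le d-1$), depending only on $c_1,\dots,c_d$ and $p$, such that for every sequence $F$ satisfying $F(n)=c_1F(n-1)+\cdots+c_dF(n-d)$, whatever its initial values $F(0),\dots,F(d-1)$, there is a constant $K$ (which may depend on the initial values) with $$\sum_{j=0}^{n-1}F(j)^p=\sum_{0\le i_1,\dots,i_p\le d-1}\Lambda_{i_1,\dots,i_p}F(n+i_1)\cdots F(n+i_p)+K\qquad\text{for all } n\ge0.$$ -}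

module Defs where

open import Level using (Level; _⊔_) renaming (suc to lsuc)
open import Data.Nat using (ℕ; zero; suc)
import Data.Nat as ℕ
open import Data.Fin using (Fin; toℕ)
open import Data.Vec.Functional using (_∷_)
open import Data.Product using (∃; _×_)
open import Relation.Nullary using (¬_)
open import Algebra.Bundles using (CommutativeRing)

record Field (a ℓ : Level) : Set (lsuc (a ⊔ ℓ)) where
  field
    commutativeRing : CommutativeRing a ℓ
  open CommutativeRing commutativeRing public
  field
    0≉1     : ¬ (0# ≈ 1#)
    inverse : ∀ x → ¬ (x ≈ 0#) → ∃ λ y → x * y ≈ 1#

module FieldOps {a ℓ : Level} (𝕂 : Field a ℓ) where
  open Field 𝕂

  pow : Carrier → ℕ → Carrier
  pow x zero    = 1#
  pow x (suc n) = x * pow x n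

  natCast : ℕ → Carrier
  natCast zero    = 0#
  natCast (suc n) = 1# + natCast n

  sumFin : ∀ n → (Fin n → Carrier) → Carrier
  sumFin zero    f = 0#
  sumFin (suc n) f = f Fin.zero + sumFin n (λ i → f (Fin.suc i))

  prodFin : ∀ n → (Fin n → Carrier) → Carrier
  prodFin zero    f = 1#
  prodFin (suc n) f = f Fin.zero * prodFin n (λ i → f (Fin.suc i))

  sumBelow : ℕ → (ℕ → Carrier) → Carrier
  sumBelow zero    f = 0#
  sumBelow (suc n) f = sumBelow n f + f n

  sumMulti : ∀ p d → ((Fin p → Fin d) → Carrier) → Carrier
  sumMulti zero    d f = f (λ ())
  sumMulti (suc p) d f = sumFin d (λ i → sumMulti p d (λ g → f (i ∷ g)))

  CharZero : Set ℓ
  CharZero = ∀ n → ¬ (natCast (suc n) ≈ 0#)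

  AlgClosed : Set (a ⊔ ℓ)
  AlgClosed = ∀ n (coef : Fin (suc n) → Carrier) →
    ∃ λ x → pow x (suc n) + sumFin (suc n) (λ k → coef k * pow x (toℕ k)) ≈ 0#

  -- c k stands for c_{k+1}, k = 0,…,d-1.
  -- t is a root of t^d - c₁ t^(d-1) - … - c_d
  IsCharRoot : ∀ d → (Fin d → Carrier) → Carrier → Set ℓ
  IsCharRoot d c t = pow t d ≈ sumFin d (λ k → c k * pow t (d ℕ.∸ suc (toℕ k)))

  SatisfiesRec : ∀ d → (Fin d → Carrier) → (ℕ → Carrier) → Set ℓ
  SatisfiesRec d c F = ∀ n → F (n ℕ.+ d) ≈ sumFin d (λ k → c k * F (n ℕ.+ (d ℕ.∸ suc (toℕ k))))

-- Since the roots r k are distinct, the Vandermonde matrix (r k ^ i) is invertible. Hence every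
-- solution of the recurrence is an exponential polynomial F n = Σₖ aₖ rₖⁿ, and since each
-- R m - 1 with R m = r (m 1) ⋯ r (m p) is nonzero, there is a coefficient array Λ with
-- Σᵢ Λ i · r (m 1) ^ i 1 ⋯ r (m p) ^ i p = 1 / (R m - 1) for every m. A multinomial expansion
-- turns S n = Σᵢ Λ i · F (n + i 1) ⋯ F (n + i p) into Σₘ Bₘ(n) / (R m - 1), where
-- Bₘ(n) = Πⱼ a (m j) · r (m j) ^ n. As Bₘ(n + 1) = R m · Bₘ(n), we get
-- S (n + 1) - S n = Σₘ Bₘ(n) = F(n) ^ p, and the sum telescopes with K = - S 0.
{-# OPTIONS --safe #-}
module Submission where

open import Defs
open import Level using (Level; _⊔_)
open import Data.Nat using (ℕ; zero; suc; _≤_; _<_; _<?_; z<s; s≤s)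
import Data.Nat as ℕ
open import Data.Nat.Properties using (m<n⇒m<1+n; m∸n+n≡m; ≮⇒≥; +-monoʳ-<; ∸-monoʳ-<)
open import Data.Nat.Induction using (<-rec)
open import Data.Fin using (Fin; toℕ; zero; suc)
open import Data.Fin.Properties using (suc-injective; toℕ<n; 0≢1+n)
open import Data.Product using (∃; _,_; proj₁; proj₂)
open import Data.Vec.Functional using (_∷_)
open import Data.Vec.Functional.Properties using (∷-cong)
open import Function using (_∘_; Injective)
open import Relation.Nullary using (¬_; yes; no)
open import Relation.Binary.Core using (_Preserves_⟶_)
open import Relation.Binary.PropositionalEquality using (_≡_; _≗_)
import Relation.Binary.PropositionalEquality as ≡
import Algebra.Properties.Semiring.Sum as SemiringSum
import Algebra.Properties.CommutativeMonoid.Sum as CommutativeMonoidSum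
import Algebra.Properties.CommutativeSemigroup as CommutativeSemigroupProperties

module OverField {u ℓ : Level} (𝕂 : Field u ℓ) where
  open Field 𝕂 hiding (zero)
  open FieldOps 𝕂
  open import Algebra.Properties.Group +-group using (x∙y⁻¹≈ε⇒x≈y; //-rightDividesˡ)
  open import Algebra.Properties.Semiring.Exp semiring using (_^_; ^-homo-*)
  open import Relation.Binary.Reasoning.Setoid setoid
  module ∑ = SemiringSum semiring
  module ∏ = CommutativeMonoidSum *-commutativeMonoid
  module +-Props = CommutativeSemigroupProperties +-commutativeSemigroup
  module *-Props = CommutativeSemigroupProperties *-commutativeSemigroup

  inv : ∀ x → ¬ x ≈ 0# → Carrier
  inv x x≉0 = proj₁ (inverse x x≉0)

  *-inverseʳ : ∀ x (x≉0 : ¬ x ≈ 0#) → x * inv x x≉0 ≈ 1#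
  *-inverseʳ x x≉0 = proj₂ (inverse x x≉0)

  inv-cong : ∀ {x y} (x≉0 : ¬ x ≈ 0#) (y≉0 : ¬ y ≈ 0#) → x ≈ y → inv x x≉0 ≈ inv y y≉0
  inv-cong {x} {y} x≉0 y≉0 x≈y = begin
    inv x x≉0                    ≈⟨ *-identityʳ _ ⟨
    inv x x≉0 * 1#               ≈⟨ *-congˡ (*-inverseʳ y y≉0) ⟨
    inv x x≉0 * (y * inv y y≉0)  ≈⟨ *-congˡ (*-congʳ x≈y) ⟨
    inv x x≉0 * (x * inv y y≉0)  ≈⟨ *-Props.x∙yz≈yx∙z _ _ _ ⟩
    (x * inv x x≉0) * inv y y≉0  ≈⟨ *-congʳ (*-inverseʳ x x≉0) ⟩
    1# * inv y y≉0               ≈⟨ *-identityˡ _ ⟩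
    inv y y≉0                    ∎

  x≉y⇒x-y≉0 : ∀ {x y} → ¬ x ≈ y → ¬ (x - y ≈ 0#)
  x≉y⇒x-y≉0 {x} {y} x≉y x-y≈0 = x≉y (x∙y⁻¹≈ε⇒x≈y x y x-y≈0)

  y+[x-y]≈x : ∀ x y → y + (x - y) ≈ x
  y+[x-y]≈x x y = trans (+-comm y (x - y)) (//-rightDividesˡ y x)

  sumFin≡sum : ∀ n f → sumFin n f ≡ ∑.sum f
  sumFin≡sum zero    f = ≡.refl
  sumFin≡sum (suc n) f = ≡.cong (f zero +_) (sumFin≡sum n (f ∘ suc))

  prodFin≡product : ∀ n f → prodFin n f ≡ ∏.sum f
  prodFin≡product zero    f = ≡.refl
  prodFin≡product (suc n) f = ≡.cong (f zero *_) (prodFin≡product n (f ∘ suc))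

  pow≡^ : ∀ x n → pow x n ≡ x ^ n
  pow≡^ x zero    = ≡.refl
  pow≡^ x (suc n) = ≡.cong (x *_) (pow≡^ x n)

  -- Abstracting over the functional lets sumFin and sumMulti be interchanged with each other.
  record IsLinear {I : Set} (S : (I → Carrier) → Carrier) : Set (u ⊔ ℓ) where
    field
      cong       : ∀ {f g} → (∀ i → f i ≈ g i) → S f ≈ S g
      distrib-+  : ∀ f g → S (λ i → f i + g i) ≈ S f + S g
      *-distribˡ : ∀ x f → x * S f ≈ S (λ i → x * f i)

    *-distribʳ : ∀ x f → S f * x ≈ S (λ i → f i * x)
    *-distribʳ x f = trans (*-comm _ x) (trans (*-distribˡ x f) (cong (λ i → *-comm x (f i))))

    on-0 : S (λ _ → 0#) ≈ 0#
    on-0 = begin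
      S (λ _ → 0#)       ≈⟨ cong (λ _ → zeroˡ 0#) ⟨
      S (λ _ → 0# * 0#)  ≈⟨ *-distribˡ 0# _ ⟨
      0# * S (λ _ → 0#)  ≈⟨ zeroˡ _ ⟩
      0#                 ∎

  sumFin-isLinear : ∀ n → IsLinear (sumFin n)
  sumFin-isLinear n = record { cong = cong ; distrib-+ = distrib-+ ; *-distribˡ = *-distribˡ }
    where
    cong : ∀ {f g} → (∀ i → f i ≈ g i) → sumFin n f ≈ sumFin n g
    cong {f} {g} f≈g rewrite sumFin≡sum n f | sumFin≡sum n g = ∑.sum-cong-≋ f≈g

    distrib-+ : ∀ f g → sumFin n (λ i → f i + g i) ≈ sumFin n f + sumFin n g
    distrib-+ f g rewrite sumFin≡sum n (λ i → f i + g i) | sumFin≡sum n f | sumFin≡sum n g =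
      ∑.∑-distrib-+ f g

    *-distribˡ : ∀ x f → x * sumFin n f ≈ sumFin n (λ i → x * f i)
    *-distribˡ x f rewrite sumFin≡sum n f | sumFin≡sum n (λ i → x * f i) = ∑.*-distribˡ-sum x f

  sumFin-comm : ∀ {I : Set} {S : (I → Carrier) → Carrier} → IsLinear S →
                ∀ n (f : Fin n → I → Carrier) →
                sumFin n (λ k → S (f k)) ≈ S (λ i → sumFin n (λ k → f k i))
  sumFin-comm S-linear zero    f = sym (IsLinear.on-0 S-linear)
  sumFin-comm S-linear (suc n) f =
    trans (+-congˡ (sumFin-comm S-linear n (f ∘ suc))) (sym (IsLinear.distrib-+ S-linear _ _))

  sumMulti-isLinear : ∀ p d → IsLinear (sumMulti p d)
  sumMulti-isLinear zero    d = record
    { cong = λ f≈g → f≈g _ ; distrib-+ = λ _ _ → refl ; *-distribˡ = λ _ _ → refl }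
  sumMulti-isLinear (suc p) d = record
    { cong       = λ f≈g → Σd.cong (λ i → Σp.cong (λ g → f≈g (i ∷ g)))
    ; distrib-+  = λ f g → trans (Σd.cong (λ i → Σp.distrib-+ _ _)) (Σd.distrib-+ _ _)
    ; *-distribˡ = λ x f → trans (Σd.*-distribˡ x _) (Σd.cong (λ i → Σp.*-distribˡ x _))
    }
    where module Σd = IsLinear (sumFin-isLinear d)
          module Σp = IsLinear (sumMulti-isLinear p d)

  sumMulti-comm : ∀ {I : Set} {S : (I → Carrier) → Carrier} → IsLinear S →
                  ∀ p d (f : (Fin p → Fin d) → I → Carrier) →
                  sumMulti p d (λ m → S (f m)) ≈ S (λ i → sumMulti p d (λ m → f m i))
  sumMulti-comm S-linear zero    d f = refl
  sumMulti-comm S-linear (suc p) d f =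
    trans (IsLinear.cong (sumFin-isLinear d) (λ k → sumMulti-comm S-linear p d (f ∘ (k ∷_))))
          (sumFin-comm S-linear d (λ k i → sumMulti p d (λ g → f (k ∷ g) i)))

  prodFin-cong : ∀ n {f g} → (∀ i → f i ≈ g i) → prodFin n f ≈ prodFin n g
  prodFin-cong n {f} {g} f≈g rewrite prodFin≡product n f | prodFin≡product n g = ∏.sum-cong-≋ f≈g

  prodFin-distrib-* : ∀ n f g → prodFin n (λ j → f j * g j) ≈ prodFin n f * prodFin n g
  prodFin-distrib-* n f g
    rewrite prodFin≡product n (λ j → f j * g j) | prodFin≡product n f | prodFin≡product n g =
    ∏.∑-distrib-+ f g

  pow≈prodFin : ∀ x n → pow x n ≈ prodFin n (λ _ → x)
  pow≈prodFin x n rewrite pow≡^ x n | prodFin≡product n (λ _ → x) = sym (∏.sum-replicate n)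

  pow-+ : ∀ x m n → pow x (m ℕ.+ n) ≈ pow x m * pow x n
  pow-+ x m n rewrite pow≡^ x (m ℕ.+ n) | pow≡^ x m | pow≡^ x n = ^-homo-* x m n

  prodFin-sumFin : ∀ p d (f : Fin p → Fin d → Carrier) →
                   prodFin p (λ j → sumFin d (f j)) ≈ sumMulti p d (λ m → prodFin p (λ j → f j (m j)))
  prodFin-sumFin zero    d f = refl
  prodFin-sumFin (suc p) d f = begin
    sumFin d (f zero) * prodFin p (λ j → sumFin d (f (suc j)))
      ≈⟨ *-congˡ (prodFin-sumFin p d (f ∘ suc)) ⟩
    sumFin d (f zero) * sumMulti p d (λ g → tail-prod g)
      ≈⟨ Σd.*-distribʳ _ (f zero) ⟩
    sumFin d (λ k → f zero k * sumMulti p d (λ g → tail-prod g))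
      ≈⟨ Σd.cong (λ k → Σp.*-distribˡ (f zero k) tail-prod) ⟩
    sumFin d (λ k → sumMulti p d (λ g → f zero k * tail-prod g)) ∎
    where
    tail-prod : (Fin p → Fin d) → Carrier
    tail-prod g = prodFin p (λ j → f (suc j) (g j))
    module Σd = IsLinear (sumFin-isLinear d)
    module Σp = IsLinear (sumMulti-isLinear p d)

  δ : ∀ {d} → Fin d → Fin d → Carrier
  δ zero    zero     = 1#
  δ zero    (suc _)  = 0#
  δ (suc _) zero     = 0#
  δ (suc k) (suc k′) = δ k k′

  sumFin-δ : ∀ d (f : Fin d → Carrier) k′ → sumFin d (λ k → f k * δ k k′) ≈ f k′
  sumFin-δ (suc d) f zero = begin
    f zero * 1# + sumFin d (λ k → f (suc k) * 0#)
      ≈⟨ +-cong (*-identityʳ _) (IsLinear.cong (sumFin-isLinear d) (λ k → zeroʳ _)) ⟩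
    f zero + sumFin d (λ _ → 0#) ≈⟨ +-congˡ (IsLinear.on-0 (sumFin-isLinear d)) ⟩
    f zero + 0#                  ≈⟨ +-identityʳ _ ⟩
    f zero                       ∎
  sumFin-δ (suc d) f (suc k′) = trans (+-cong (zeroʳ _) (sumFin-δ d (f ∘ suc) k′)) (+-identityˡ _)

  sumMulti-δ : ∀ p d (Y : (Fin p → Fin d) → Carrier) → Y Preserves _≗_ ⟶ _≈_ →
               ∀ m′ → sumMulti p d (λ m → Y m * prodFin p (λ j → δ (m j) (m′ j))) ≈ Y m′
  sumMulti-δ zero    d Y Y-cong m′ = trans (*-identityʳ _) (Y-cong (λ ()))
  sumMulti-δ (suc p) d Y Y-cong m′ = begin
    sumFin d (λ k → sumMulti p d (λ g → Y (k ∷ g) * (δ k (m′ zero) * Δ g)))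
      ≈⟨ Σd.cong (λ k → Σp.cong (λ g → *-Props.x∙yz≈xz∙y _ _ _)) ⟩
    sumFin d (λ k → sumMulti p d (λ g → (Y (k ∷ g) * Δ g) * δ k (m′ zero)))
      ≈⟨ Σd.cong (λ k → Σp.*-distribʳ _ _) ⟨
    sumFin d (λ k → sumMulti p d (λ g → Y (k ∷ g) * Δ g) * δ k (m′ zero))
      ≈⟨ Σd.cong (λ k → *-congʳ (sumMulti-δ p d (Y ∘ (k ∷_)) (Y-cong ∘ ∷-cong ≡.refl) (m′ ∘ suc))) ⟩
    sumFin d (λ k → Y (k ∷ m′ ∘ suc) * δ k (m′ zero))
      ≈⟨ sumFin-δ d (λ k → Y (k ∷ m′ ∘ suc)) (m′ zero) ⟩
    Y (m′ zero ∷ m′ ∘ suc)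
      ≈⟨ Y-cong (∷-cong ≡.refl (λ _ → ≡.refl)) ⟩
    Y m′ ∎
    where
    Δ : (Fin p → Fin d) → Carrier
    Δ g = prodFin p (λ j → δ (g j) (m′ (suc j)))
    module Σd = IsLinear (sumFin-isLinear d)
    module Σp = IsLinear (sumMulti-isLinear p d)

  -- Polynomial interpolation

  eval : ∀ {d} → (Fin d → Carrier) → Carrier → Carrier
  eval {d} P t = sumFin d (λ i → P i * pow t (toℕ i))

  expPoly : ∀ {d} → (Fin d → Carrier) → (Fin d → Carrier) → ℕ → Carrier
  expPoly {d} a r n = sumFin d (λ m → a m * pow (r m) n)

  padZero : ∀ {d} → (Fin d → Carrier) → Fin (suc d) → Carrier
  padZero {zero}  Q _       = 0#
  padZero {suc d} Q zero    = Q zero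
  padZero {suc d} Q (suc i) = padZero (Q ∘ suc) i

  sumFin-padZero : ∀ d (Q : Fin d → Carrier) (g : ℕ → Carrier) →
                   sumFin (suc d) (λ i → padZero Q i * g (toℕ i)) ≈ sumFin d (λ i → Q i * g (toℕ i))
  sumFin-padZero zero    Q g = trans (+-identityʳ _) (zeroˡ _)
  sumFin-padZero (suc d) Q g = +-congˡ (sumFin-padZero d (Q ∘ suc) (g ∘ suc))

  eval-∷ : ∀ {d} c (Q : Fin d → Carrier) t → eval (c ∷ Q) t ≈ c + t * eval Q t
  eval-∷ {d} c Q t = +-cong (*-identityʳ c) (begin
    sumFin d (λ i → Q i * (t * pow t (toℕ i)))  ≈⟨ Σd.cong (λ i → *-Props.x∙yz≈y∙xz _ _ _) ⟩
    sumFin d (λ i → t * (Q i * pow t (toℕ i)))  ≈⟨ Σd.*-distribˡ t _ ⟨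
    t * eval Q t                                ∎)
    where module Σd = IsLinear (sumFin-isLinear d)

  newton : ∀ {d} → Carrier → Carrier → (Fin d → Carrier) → Fin (suc d) → Carrier
  newton c s Q i = (c ∷ Q) i + (- s) * padZero Q i

  eval-newton : ∀ {d} c s (Q : Fin d → Carrier) t → eval (newton c s Q) t ≈ c + (t - s) * eval Q t
  eval-newton {d} c s Q t = begin
    eval (newton c s Q) t
      ≈⟨ Σ.cong (λ i → trans (distribʳ (tⁱ i) ((c ∷ Q) i) _)
                             (+-congˡ (*-assoc (- s) (padZero Q i) (tⁱ i)))) ⟩
    sumFin (suc d) (λ i → (c ∷ Q) i * tⁱ i + (- s) * (padZero Q i * tⁱ i))
      ≈⟨ Σ.distrib-+ (λ i → (c ∷ Q) i * tⁱ i) (λ i → (- s) * (padZero Q i * tⁱ i)) ⟩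
    eval (c ∷ Q) t + sumFin (suc d) (λ i → (- s) * (padZero Q i * tⁱ i))
      ≈⟨ +-congˡ (Σ.*-distribˡ (- s) (λ i → padZero Q i * tⁱ i)) ⟨
    eval (c ∷ Q) t + (- s) * sumFin (suc d) (λ i → padZero Q i * tⁱ i)
      ≈⟨ +-cong (eval-∷ c Q t) (*-congˡ (sumFin-padZero d Q (pow t))) ⟩
    (c + t * eval Q t) + (- s) * eval Q t
      ≈⟨ +-assoc _ _ _ ⟩
    c + (t * eval Q t + (- s) * eval Q t)
      ≈⟨ +-congˡ (distribʳ _ _ _) ⟨
    c + (t - s) * eval Q t ∎
    where
    module Σ = IsLinear (sumFin-isLinear (suc d))
    tⁱ : Fin (suc d) → Carrier
    tⁱ i = pow t (toℕ i)

  module _ {d} (r : Fin (suc d) → Carrier) (r-injective : Injective _≡_ _≈_ r) where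

    tail-injective : Injective _≡_ _≈_ (r ∘ suc)
    tail-injective = suc-injective ∘ r-injective

    gap≉0 : ∀ m → ¬ (r (suc m) - r zero ≈ 0#)
    gap≉0 m = x≉y⇒x-y≉0 (λ r-suc-m≈r-zero → 0≢1+n (≡.sym (r-injective r-suc-m≈r-zero)))

    gap⁻¹ : Fin d → Carrier
    gap⁻¹ m = inv (r (suc m) - r zero) (gap≉0 m)

  interpolation : ∀ d (r : Fin d → Carrier) → Injective _≡_ _≈_ r → ∀ (y : Fin d → Carrier) →
                  ∃ λ (P : Fin d → Carrier) → ∀ k → eval P (r k) ≈ y k
  interpolation zero    r r-injective y = (λ ()) , λ ()
  interpolation (suc d) r r-injective y = newton (y zero) (r zero) Q , interpolates
    where
    -- Newton's divided differences
    y′ : Fin d → Carrier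
    y′ k = (y (suc k) - y zero) * gap⁻¹ r r-injective k

    Q : Fin d → Carrier
    Q = proj₁ (interpolation d (r ∘ suc) (tail-injective r r-injective) y′)

    Q-interpolates : ∀ k → eval Q (r (suc k)) ≈ y′ k
    Q-interpolates = proj₂ (interpolation d (r ∘ suc) (tail-injective r r-injective) y′)

    interpolates : ∀ k → eval (newton (y zero) (r zero) Q) (r k) ≈ y k
    interpolates zero = begin
      eval (newton (y zero) (r zero) Q) (r zero) ≈⟨ eval-newton _ _ Q _ ⟩
      y zero + (r zero - r zero) * eval Q (r zero) ≈⟨ +-congˡ (*-congʳ (-‿inverseʳ _)) ⟩
      y zero + 0# * eval Q (r zero)               ≈⟨ +-congˡ (zeroˡ _) ⟩
      y zero + 0#                                 ≈⟨ +-identityʳ _ ⟩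
      y zero                                      ∎
    interpolates (suc k) = begin
      eval (newton (y zero) (r zero) Q) (r (suc k))
        ≈⟨ eval-newton _ _ Q _ ⟩
      y zero + (r (suc k) - r zero) * eval Q (r (suc k))
        ≈⟨ +-congˡ (*-congˡ (Q-interpolates k)) ⟩
      y zero + (r (suc k) - r zero) * ((y (suc k) - y zero) * gap⁻¹ r r-injective k)
        ≈⟨ +-congˡ (*-Props.x∙yz≈y∙xz _ _ _) ⟩
      y zero + (y (suc k) - y zero) * ((r (suc k) - r zero) * gap⁻¹ r r-injective k)
        ≈⟨ +-congˡ (trans (*-congˡ (*-inverseʳ _ _)) (*-identityʳ _)) ⟩
      y zero + (y (suc k) - y zero)
        ≈⟨ y+[x-y]≈x _ _ ⟩
      y (suc k) ∎

  expPoly-suc : ∀ {d} (r : Fin (suc d) → Carrier) A (a b : Fin d → Carrier) →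
                (∀ m → (r (suc m) - r zero) * a m ≈ b m) →
                ∀ i → expPoly (A ∷ a) r (suc i) ≈ r zero * expPoly (A ∷ a) r i + expPoly b (r ∘ suc) i
  expPoly-suc {d} r A a b gap*a≈b i = begin
    A * (r zero * pow (r zero) i) + sumFin d (λ m → a m * (r (suc m) * pow (r (suc m)) i))
      ≈⟨ +-cong (*-Props.x∙yz≈y∙xz _ _ _) (trans (Σd.cong summand-suc) (Σd.distrib-+ _ _)) ⟩
    r zero * (A * pow (r zero) i)
      + (sumFin d (λ m → r zero * (a m * pow (r (suc m)) i)) + expPoly b (r ∘ suc) i)
      ≈⟨ +-congˡ (+-congʳ (Σd.*-distribˡ _ _)) ⟨
    r zero * (A * pow (r zero) i) + (r zero * expPoly a (r ∘ suc) i + expPoly b (r ∘ suc) i)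
      ≈⟨ +-assoc _ _ _ ⟨
    (r zero * (A * pow (r zero) i) + r zero * expPoly a (r ∘ suc) i) + expPoly b (r ∘ suc) i
      ≈⟨ +-congʳ (distribˡ _ _ _) ⟨
    r zero * expPoly (A ∷ a) r i + expPoly b (r ∘ suc) i ∎
    where
    module Σd = IsLinear (sumFin-isLinear d)
    summand-suc : ∀ m → a m * (r (suc m) * pow (r (suc m)) i)
                     ≈ r zero * (a m * pow (r (suc m)) i) + b m * pow (r (suc m)) i
    summand-suc m = begin
      a m * (r (suc m) * t)                            ≈⟨ *-congˡ (*-congʳ (y+[x-y]≈x _ _)) ⟨
      a m * ((r zero + (r (suc m) - r zero)) * t)      ≈⟨ *-congˡ (distribʳ _ _ _) ⟩
      a m * (r zero * t + (r (suc m) - r zero) * t)    ≈⟨ distribˡ _ _ _ ⟩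
      a m * (r zero * t) + a m * ((r (suc m) - r zero) * t)
        ≈⟨ +-cong (*-Props.x∙yz≈y∙xz _ _ _) (*-Props.x∙yz≈yx∙z _ _ _) ⟩
      r zero * (a m * t) + ((r (suc m) - r zero) * a m) * t ≈⟨ +-congˡ (*-congʳ (gap*a≈b m)) ⟩
      r zero * (a m * t) + b m * t                     ∎
      where t = pow (r (suc m)) i

  transposedInterpolation : ∀ d (r : Fin d → Carrier) → Injective _≡_ _≈_ r → ∀ (x : ℕ → Carrier) →
                            ∃ λ (a : Fin d → Carrier) → ∀ i → i < d → expPoly a r i ≈ x i
  transposedInterpolation zero    r r-injective x = (λ ()) , λ _ ()
  transposedInterpolation (suc d) r r-injective x = A ∷ a , interpolates
    where
    -- passing to x (i + 1) - r₀ · x i removes the root r₀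
    b-fits : ∃ λ (b : Fin d → Carrier) →
               ∀ i → i < d → expPoly b (r ∘ suc) i ≈ x (suc i) - r zero * x i
    b-fits = transposedInterpolation d (r ∘ suc) (tail-injective r r-injective)
                                     (λ i → x (suc i) - r zero * x i)

    b : Fin d → Carrier
    b = proj₁ b-fits

    a : Fin d → Carrier
    a m = b m * gap⁻¹ r r-injective m

    A : Carrier
    A = x 0 - sumFin d a

    gap*a≈b : ∀ m → (r (suc m) - r zero) * a m ≈ b m
    gap*a≈b m = trans (*-Props.x∙yz≈y∙xz _ _ _) (trans (*-congˡ (*-inverseʳ _ _)) (*-identityʳ _))

    interpolates : ∀ i → i < suc d → expPoly (A ∷ a) r i ≈ x i
    interpolates zero _ = begin
      A * 1# + sumFin d (λ m → a m * 1#)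
        ≈⟨ +-cong (*-identityʳ A) (IsLinear.cong (sumFin-isLinear d) (λ m → *-identityʳ _)) ⟩
      A + sumFin d a ≈⟨ //-rightDividesˡ _ _ ⟩
      x 0            ∎
    interpolates (suc i) (s≤s i<d) = begin
      expPoly (A ∷ a) r (suc i)
        ≈⟨ expPoly-suc r A a b gap*a≈b i ⟩
      r zero * expPoly (A ∷ a) r i + expPoly b (r ∘ suc) i
        ≈⟨ +-cong (*-congˡ (interpolates i (m<n⇒m<1+n i<d)))
                  (proj₂ b-fits i i<d) ⟩
      r zero * x i + (x (suc i) - r zero * x i)
        ≈⟨ y+[x-y]≈x _ _ ⟩
      x (suc i) ∎

  eval⊗ : ∀ {p d} → ((Fin p → Fin d) → Carrier) → (Fin p → Carrier) → Carrier
  eval⊗ {p} {d} Λ t = sumMulti p d (λ i → Λ i * prodFin p (λ j → pow (t j) (toℕ (i j))))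

  eval⊗-prodFin : ∀ p d (P : Fin p → Fin d → Carrier) (t : Fin p → Carrier) →
                  eval⊗ (λ i → prodFin p (λ j → P j (i j))) t ≈ prodFin p (λ j → eval (P j) (t j))
  eval⊗-prodFin p d P t = begin
    sumMulti p d (λ i → prodFin p (λ j → P j (i j)) * prodFin p (λ j → pow (t j) (toℕ (i j))))
      ≈⟨ IsLinear.cong (sumMulti-isLinear p d) (λ i → prodFin-distrib-* p _ _) ⟨
    sumMulti p d (λ i → prodFin p (λ j → P j (i j) * pow (t j) (toℕ (i j))))
      ≈⟨ prodFin-sumFin p d (λ j k → P j k * pow (t j) (toℕ k)) ⟨
    prodFin p (λ j → eval (P j) (t j)) ∎

  gridInterpolation : ∀ p d (r : Fin d → Carrier) → Injective _≡_ _≈_ r →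
                      ∀ (Y : (Fin p → Fin d) → Carrier) → Y Preserves _≗_ ⟶ _≈_ →
                      ∃ λ (Λ : (Fin p → Fin d) → Carrier) → ∀ m → eval⊗ Λ (r ∘ m) ≈ Y m
  gridInterpolation p d r r-injective Y Y-cong = Λ , interpolates
    where
    L : Fin d → Fin d → Carrier
    L k = proj₁ (interpolation d r r-injective (δ k))

    L-lagrange : ∀ k k′ → eval (L k) (r k′) ≈ δ k k′
    L-lagrange k = proj₂ (interpolation d r r-injective (δ k))

    L⊗ : (Fin p → Fin d) → (Fin p → Fin d) → Carrier
    L⊗ m i = prodFin p (λ j → L (m j) (i j))

    -- the coefficients of Σₘ Y m · Πⱼ eval (L (m j)) (t j)
    Λ : (Fin p → Fin d) → Carrier
    Λ i = sumMulti p d (λ m → Y m * L⊗ m i)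

    module Σ = IsLinear (sumMulti-isLinear p d)

    interpolates : ∀ m′ → eval⊗ Λ (r ∘ m′) ≈ Y m′
    interpolates m′ = begin
      sumMulti p d (λ i → sumMulti p d (λ m → Y m * L⊗ m i) * rⁱ i)
        ≈⟨ Σ.cong (λ i → trans (Σ.*-distribʳ (rⁱ i) _) (Σ.cong (λ m → *-assoc _ _ _))) ⟩
      sumMulti p d (λ i → sumMulti p d (λ m → Y m * (L⊗ m i * rⁱ i)))
        ≈⟨ sumMulti-comm (sumMulti-isLinear p d) p d (λ m i → Y m * (L⊗ m i * rⁱ i)) ⟨
      sumMulti p d (λ m → sumMulti p d (λ i → Y m * (L⊗ m i * rⁱ i)))
        ≈⟨ Σ.cong (λ m → Σ.*-distribˡ (Y m) _) ⟨
      sumMulti p d (λ m → Y m * eval⊗ (L⊗ m) (r ∘ m′))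
        ≈⟨ Σ.cong (λ m → *-congˡ (eval⊗-prodFin p d (L ∘ m) (r ∘ m′))) ⟩
      sumMulti p d (λ m → Y m * prodFin p (λ j → eval (L (m j)) (r (m′ j))))
        ≈⟨ Σ.cong (λ m → *-congˡ (prodFin-cong p (λ j → L-lagrange (m j) (m′ j)))) ⟩
      sumMulti p d (λ m → Y m * prodFin p (λ j → δ (m j) (m′ j)))
        ≈⟨ sumMulti-δ p d Y Y-cong m′ ⟩
      Y m′ ∎
      where
      rⁱ : (Fin p → Fin d) → Carrier
      rⁱ i = prodFin p (λ j → pow (r (m′ j)) (toℕ (i j)))

  -- Linear recurrences

  module _ {d : ℕ} (c : Fin d → Carrier) where

    lag : Fin d → ℕ
    lag k = d ℕ.∸ suc (toℕ k)

    pow-satisfiesRec : ∀ t → IsCharRoot d c t → SatisfiesRec d c (pow t)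
    pow-satisfiesRec t root n = begin
      pow t (n ℕ.+ d)                                    ≈⟨ pow-+ t n d ⟩
      pow t n * pow t d                                  ≈⟨ *-congˡ root ⟩
      pow t n * sumFin d (λ k → c k * pow t (lag k))     ≈⟨ Σd.*-distribˡ _ _ ⟩
      sumFin d (λ k → pow t n * (c k * pow t (lag k)))
        ≈⟨ Σd.cong (λ k → trans (*-Props.x∙yz≈y∙xz _ _ _) (*-congˡ (sym (pow-+ t n (lag k))))) ⟩
      sumFin d (λ k → c k * pow t (n ℕ.+ lag k))         ∎
      where module Σd = IsLinear (sumFin-isLinear d)

    satisfiesRec-combination : ∀ q (G : Fin q → ℕ → Carrier) → (∀ m → SatisfiesRec d c (G m)) →
                               ∀ (a : Fin q → Carrier) →
                               SatisfiesRec d c (λ n → sumFin q (λ m → a m * G m n))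
    satisfiesRec-combination q G G-rec a n = begin
      sumFin q (λ m → a m * G m (n ℕ.+ d))
        ≈⟨ Σq.cong (λ m → *-congˡ (G-rec m n)) ⟩
      sumFin q (λ m → a m * sumFin d (λ k → c k * G m (n ℕ.+ lag k)))
        ≈⟨ Σq.cong (λ m → trans (Σd.*-distribˡ _ _) (Σd.cong (λ k → *-Props.x∙yz≈y∙xz _ _ _))) ⟩
      sumFin q (λ m → sumFin d (λ k → c k * (a m * G m (n ℕ.+ lag k))))
        ≈⟨ sumFin-comm (sumFin-isLinear d) q _ ⟩
      sumFin d (λ k → sumFin q (λ m → c k * (a m * G m (n ℕ.+ lag k))))
        ≈⟨ Σd.cong (λ k → Σq.*-distribˡ _ _) ⟨
      sumFin d (λ k → c k * sumFin q (λ m → a m * G m (n ℕ.+ lag k))) ∎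
      where module Σd = IsLinear (sumFin-isLinear d)
            module Σq = IsLinear (sumFin-isLinear q)

    satisfiesRec-unique : ∀ {F G} → SatisfiesRec d c F → SatisfiesRec d c G →
                          (∀ i → i < d → F i ≈ G i) → ∀ n → F n ≈ G n
    satisfiesRec-unique {F} {G} F-rec G-rec initial = <-rec (λ n → F n ≈ G n) agree
      where
      agree : ∀ n → (∀ {i} → i < n → F i ≈ G i) → F n ≈ G n
      agree n earlier with n <? d
      ... | yes n<d = initial n n<d
      ... | no n≮d = begin
        F n                                   ≡⟨ ≡.cong F n-d+d≡n ⟨
        F (n ℕ.∸ d ℕ.+ d)                     ≈⟨ F-rec (n ℕ.∸ d) ⟩
        sumFin d (λ k → c k * F (n ℕ.∸ d ℕ.+ lag k))
          ≈⟨ IsLinear.cong (sumFin-isLinear d) (λ k → *-congˡ (earlier (lag<n k))) ⟩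
        sumFin d (λ k → c k * G (n ℕ.∸ d ℕ.+ lag k)) ≈⟨ G-rec (n ℕ.∸ d) ⟨
        G (n ℕ.∸ d ℕ.+ d)                     ≡⟨ ≡.cong G n-d+d≡n ⟩
        G n                                   ∎
        where
        n-d+d≡n : n ℕ.∸ d ℕ.+ d ≡ n
        n-d+d≡n = m∸n+n≡m (≮⇒≥ n≮d)

        lag<n : ∀ k → n ℕ.∸ d ℕ.+ lag k < n
        lag<n k = ≡.subst (n ℕ.∸ d ℕ.+ lag k <_) n-d+d≡n
                          (+-monoʳ-< (n ℕ.∸ d) (∸-monoʳ-< z<s (toℕ<n k)))

  satisfiesRec⇒expPoly : ∀ d (c r : Fin d → Carrier) → (∀ m → IsCharRoot d c (r m)) →
                         Injective _≡_ _≈_ r → ∀ {F} → SatisfiesRec d c F →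
                         ∃ λ (a : Fin d → Carrier) → ∀ n → F n ≈ expPoly a r n
  satisfiesRec⇒expPoly d c r roots r-injective {F} F-rec =
    a , satisfiesRec-unique c F-rec expPoly-rec initial
    where
    a : Fin d → Carrier
    a = proj₁ (transposedInterpolation d r r-injective F)

    initial : ∀ i → i < d → F i ≈ expPoly a r i
    initial i i<d = sym (proj₂ (transposedInterpolation d r r-injective F) i i<d)

    expPoly-rec : SatisfiesRec d c (expPoly a r)
    expPoly-rec = satisfiesRec-combination c d (pow ∘ r) (λ m → pow-satisfiesRec c (r m) (roots m)) a

  -- Power sums

  sumBelow-telescope : ∀ (f S : ℕ → Carrier) → (∀ n → S (suc n) ≈ S n + f n) →
                       ∀ n → sumBelow n f ≈ S n - S 0
  sumBelow-telescope f S S-suc zero    = sym (-‿inverseʳ (S 0))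
  sumBelow-telescope f S S-suc (suc n) = begin
    sumBelow n f + f n     ≈⟨ +-congʳ (sumBelow-telescope f S S-suc n) ⟩
    (S n - S 0) + f n      ≈⟨ +-Props.xy∙z≈xz∙y _ _ _ ⟩
    (S n + f n) - S 0      ≈⟨ +-congʳ (S-suc n) ⟨
    S (suc n) - S 0        ∎

  shiftForm : ∀ {p d} → ((Fin p → Fin d) → Carrier) → (ℕ → Carrier) → ℕ → Carrier
  shiftForm {p} {d} Λ F n = sumMulti p d (λ i → Λ i * prodFin p (λ j → F (n ℕ.+ toℕ (i j))))

  x*y≈y+1 : ∀ {x y} → (x - 1#) * y ≈ 1# → x * y ≈ y + 1#
  x*y≈y+1 {x} {y} [x-1]*y≈1 = begin
    x * y                  ≈⟨ *-congʳ (//-rightDividesˡ 1# x) ⟨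
    ((x - 1#) + 1#) * y    ≈⟨ distribʳ y _ _ ⟩
    (x - 1#) * y + 1# * y  ≈⟨ +-cong [x-1]*y≈1 (*-identityˡ y) ⟩
    1# + y                 ≈⟨ +-comm 1# y ⟩
    y + 1#                 ∎

  module _ {d} (p : ℕ) (a r : Fin d → Carrier) {F : ℕ → Carrier}
           (F≈expPoly : ∀ n → F n ≈ expPoly a r n) where

    private
      module Σ = IsLinear (sumMulti-isLinear p d)

    multinomialTerm : (Fin p → Fin d) → ℕ → Carrier
    multinomialTerm m n = prodFin p (λ j → a (m j) * pow (r (m j)) n)

    multinomialTerm-suc : ∀ m n → multinomialTerm m (suc n) ≈ multinomialTerm m n * prodFin p (r ∘ m)
    multinomialTerm-suc m n =
      trans (prodFin-cong p (λ j → *-Props.x∙yz≈xz∙y _ _ _)) (prodFin-distrib-* p _ _)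

    pow-expansion : ∀ n → pow (F n) p ≈ sumMulti p d (λ m → multinomialTerm m n)
    pow-expansion n = begin
      pow (F n) p                     ≈⟨ pow≈prodFin (F n) p ⟩
      prodFin p (λ _ → F n)           ≈⟨ prodFin-cong p (λ _ → F≈expPoly n) ⟩
      prodFin p (λ _ → expPoly a r n) ≈⟨ prodFin-sumFin p d (λ _ m → a m * pow (r m) n) ⟩
      sumMulti p d (λ m → multinomialTerm m n) ∎

    prodFin-shift-expansion : ∀ n (i : Fin p → Fin d) →
      prodFin p (λ j → F (n ℕ.+ toℕ (i j)))
        ≈ sumMulti p d (λ m → multinomialTerm m n * prodFin p (λ j → pow (r (m j)) (toℕ (i j))))
    prodFin-shift-expansion n i = begin
      prodFin p (λ j → F (n ℕ.+ toℕ (i j)))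
        ≈⟨ prodFin-cong p (λ j → trans (F≈expPoly _) (IsLinear.cong (sumFin-isLinear d) (λ k →
             trans (*-congˡ (pow-+ (r k) n (toℕ (i j)))) (sym (*-assoc _ _ _))))) ⟩
      prodFin p (λ j → sumFin d (λ k → (a k * pow (r k) n) * pow (r k) (toℕ (i j))))
        ≈⟨ prodFin-sumFin p d (λ j k → (a k * pow (r k) n) * pow (r k) (toℕ (i j))) ⟩
      sumMulti p d (λ m → prodFin p (λ j → (a (m j) * pow (r (m j)) n) * pow (r (m j)) (toℕ (i j))))
        ≈⟨ Σ.cong (λ m → prodFin-distrib-* p _ _) ⟩
      sumMulti p d (λ m → multinomialTerm m n * prodFin p (λ j → pow (r (m j)) (toℕ (i j)))) ∎

    shiftForm-expansion : ∀ Λ n →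
      shiftForm Λ F n ≈ sumMulti p d (λ m → multinomialTerm m n * eval⊗ Λ (r ∘ m))
    shiftForm-expansion Λ n = begin
      sumMulti p d (λ i → Λ i * prodFin p (λ j → F (n ℕ.+ toℕ (i j))))
        ≈⟨ Σ.cong (λ i → *-congˡ (prodFin-shift-expansion n i)) ⟩
      sumMulti p d (λ i → Λ i * sumMulti p d (λ m → multinomialTerm m n * rⁱ m i))
        ≈⟨ Σ.cong (λ i → trans (Σ.*-distribˡ (Λ i) _) (Σ.cong (λ m → *-Props.x∙yz≈y∙xz _ _ _))) ⟩
      sumMulti p d (λ i → sumMulti p d (λ m → multinomialTerm m n * (Λ i * rⁱ m i)))
        ≈⟨ sumMulti-comm (sumMulti-isLinear p d) p d (λ m i → multinomialTerm m n * (Λ i * rⁱ m i)) ⟨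
      sumMulti p d (λ m → sumMulti p d (λ i → multinomialTerm m n * (Λ i * rⁱ m i)))
        ≈⟨ Σ.cong (λ m → Σ.*-distribˡ (multinomialTerm m n) _) ⟨
      sumMulti p d (λ m → multinomialTerm m n * eval⊗ Λ (r ∘ m)) ∎
      where
      rⁱ : (Fin p → Fin d) → (Fin p → Fin d) → Carrier
      rⁱ m i = prodFin p (λ j → pow (r (m j)) (toℕ (i j)))

    shiftForm-suc : ∀ Λ → (∀ m → (prodFin p (r ∘ m) - 1#) * eval⊗ Λ (r ∘ m) ≈ 1#) →
                    ∀ n → shiftForm Λ F (suc n) ≈ shiftForm Λ F n + pow (F n) p
    shiftForm-suc Λ reciprocal n = begin
      shiftForm Λ F (suc n)                                ≈⟨ shiftForm-expansion Λ (suc n) ⟩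
      sumMulti p d (λ m → multinomialTerm m (suc n) * W m)  ≈⟨ Σ.cong term-step ⟩
      sumMulti p d (λ m → T m * W m + T m)                  ≈⟨ Σ.distrib-+ _ _ ⟩
      sumMulti p d (λ m → T m * W m) + sumMulti p d T
        ≈⟨ +-cong (shiftForm-expansion Λ n) (pow-expansion n) ⟨
      shiftForm Λ F n + pow (F n) p                        ∎
      where
      W T : (Fin p → Fin d) → Carrier
      W m = eval⊗ Λ (r ∘ m)
      T m = multinomialTerm m n

      term-step : ∀ m → multinomialTerm m (suc n) * W m ≈ T m * W m + T m
      term-step m = begin
        multinomialTerm m (suc n) * W m  ≈⟨ *-congʳ (multinomialTerm-suc m n) ⟩
        (T m * prodFin p (r ∘ m)) * W m  ≈⟨ *-assoc _ _ _ ⟩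
        T m * (prodFin p (r ∘ m) * W m)  ≈⟨ *-congˡ (x*y≈y+1 (reciprocal m)) ⟩
        T m * (W m + 1#)                 ≈⟨ distribˡ _ _ _ ⟩
        T m * W m + T m * 1#             ≈⟨ +-congˡ (*-identityʳ _) ⟩
        T m * W m + T m                  ∎

theorem4 : ∀ {a ℓ : Level} (𝕂 : Field a ℓ) → let open Field 𝕂 in let open FieldOps 𝕂 in
    AlgClosed → CharZero →
    ∀ (d : ℕ) (c : Fin d → Carrier) (r : Fin d → Carrier) →
    (∀ m → IsCharRoot d c (r m)) →
    (∀ m m′ → r m ≈ r m′ → m ≡ m′) →
    (∀ m → ¬ (r m ≈ 0#)) →
    ∀ (p : ℕ) → 1 ≤ p →
    (∀ (m : Fin p → Fin d) → ¬ (prodFin p (λ j → r (m j)) ≈ 1#)) →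
    ∃ λ (Λ : (Fin p → Fin d) → Carrier) →
      ∀ (F : ℕ → Carrier) → SatisfiesRec d c F →
      ∃ λ (K : Carrier) → ∀ (n : ℕ) →
        sumBelow n (λ j → pow (F j) p)
          ≈ sumMulti p d (λ i → Λ i * prodFin p (λ j → F (n ℕ.+ toℕ (i j)))) + K
theorem4 𝕂 _ _ d c r roots r-distinct _ p _ R≉1 = Λ , λ F F-rec →
  let a , F≈expPoly = satisfiesRec⇒expPoly d c r roots r-injective F-rec
  in - shiftForm Λ F 0 , sumBelow-telescope _ _ (shiftForm-suc p a r F≈expPoly Λ Λ-reciprocal)
  where
  open Field 𝕂 hiding (zero)
  open FieldOps 𝕂
  open OverField 𝕂

  r-injective : Injective _≡_ _≈_ r
  r-injective = r-distinct _ _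

  R-1≉0 : ∀ m → ¬ (prodFin p (r ∘ m) - 1# ≈ 0#)
  R-1≉0 m = x≉y⇒x-y≉0 (R≉1 m)

  Y : (Fin p → Fin d) → Carrier
  Y m = inv (prodFin p (r ∘ m) - 1#) (R-1≉0 m)

  Y-cong : Y Preserves _≗_ ⟶ _≈_
  Y-cong m≗m′ = inv-cong _ _ (+-congʳ (prodFin-cong p (λ j → reflexive (≡.cong r (m≗m′ j)))))

  Λ : (Fin p → Fin d) → Carrier
  Λ = proj₁ (gridInterpolation p d r r-injective Y Y-cong)

  Λ-interpolates : ∀ m → eval⊗ Λ (r ∘ m) ≈ Y m
  Λ-interpolates = proj₂ (gridInterpolation p d r r-injective Y Y-cong)

  Λ-reciprocal : ∀ m → (prodFin p (r ∘ m) - 1#) * eval⊗ Λ (r ∘ m) ≈ 1#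
  Λ-reciprocal m = trans (*-congˡ (Λ-interpolates m)) (*-inverseʳ _ _)
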